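{- Let $G$ and $H$ be connected graphs, each with at least two vertices. Then $q(G\square H)>\max(q(G),q(H))$.
   Context: All graphs are finite, simple and undirected. For a vertex $v$, $d(v)$ is its degree, $N[v]$ its closed neighbourhood and $d[v]=d(v)+1$. A partition of a graph $G$ is a pair $(V_1,V_2)$ of nonempty disjoint sets with union $V(G)$; for $v\in V_i$, $q^i(v)=|N[v]\cap V_i|/d[v]$, and $q(G)=\max_{(V_1,V_2)}\min\{q^i(v): i\in\{1,2\}, v\in V_i\}$ over all partitions. The cartesian product $G\square H$ has vertex set $V(G)\times V(H)$, with $(g_1,h_1)$ adjacent to $(g_2,h_2)$ iff either $g_1=g_2$ and $h_1h_2\in E(H)$, or $h_1=h_2$ and $g_1g_2\in E(G)$. -}

module Defs where

open import Data.Nat using (ℕ; zero; suc; _+_; _*_; _≤_)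
open import Data.Bool using (Bool; true; false; if_then_else_; _∧_; _∨_; not)
open import Data.Fin using (Fin; zero; suc; remQuot)
open import Data.Fin.Properties using (_≟_)
open import Data.Product using (_×_; _,_; proj₁; proj₂; ∃)
open import Data.List using (List; []; _∷_; _++_; map; foldr; filterᵇ)
open import Data.Integer using (+_)
open import Data.Rational using (ℚ; _/_; _⊓_; _⊔_; 0ℚ; 1ℚ)
open import Relation.Binary.PropositionalEquality as Eq using (_≡_; refl)
open import Relation.Nullary using (yes; no)
open import Data.Empty using (⊥-elim)
import Data.Bool.Properties
open import Relation.Nullary.Decidable using (⌊_⌋)

record Graph : Set where
  field
    n     : ℕ
    adj   : Fin n → Fin n → Bool
    irrefl : ∀ v → adj v v ≡ false
    sym   : ∀ u v → adj u v ≡ adj v u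
open Graph public

data Walk (G : Graph) : Fin (n G) → Fin (n G) → Set where
  here : ∀ {v} → Walk G v v
  step : ∀ {u v w} → adj G u v ≡ true → Walk G v w → Walk G u w

Connected : Graph → Set
Connected G = ∀ u v → Walk G u v

count : ∀ {k} → (Fin k → Bool) → ℕ
count {zero}  p = 0
count {suc k} p = (if p zero then 1 else 0) + count {k} (λ i → p (suc i))

closedNbr : (G : Graph) → Fin (n G) → Fin (n G) → Bool
closedNbr G v u = ⌊ u ≟ v ⌋ ∨ adj G v u

degree : (G : Graph) → Fin (n G) → ℕ
degree G v = count (adj G v)

cdeg : (G : Graph) → Fin (n G) → ℕ
cdeg G v = suc (degree G v)

-- A 2-colouring side : Fin n → Bool encodes (V₁,V₂) = (side⁻¹ true, side⁻¹ false).
-- q^i(v) for v in its own part: |N[v] ∩ V_i| / d[v]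
qv : (G : Graph) → (Fin (n G) → Bool) → Fin (n G) → ℚ
qv G side v =
  (+ count (λ u → closedNbr G v u ∧ ⌊ Data.Bool._≟_ (side u) (side v) ⌋)) / cdeg G v

isPartition : ∀ {k} → (Fin k → Bool) → Bool
isPartition {k} side =
  not (count side Data.Nat.≡ᵇ 0) ∧ not (count (λ i → not (side i)) Data.Nat.≡ᵇ 0)

allMaps : (k : ℕ) → List (Fin k → Bool)
allMaps zero = (λ ()) ∷ []
allMaps (suc k) =
  map (λ f → λ { zero → true  ; (suc i) → f i }) (allMaps k)
  ++ map (λ f → λ { zero → false ; (suc i) → f i }) (allMaps k)

-- minimum of a rational-valued function over Fin k
-- (seeded with 1; all values q^i(v) lie in (0,1], so this is the true minimum when k ≥ 1)
minFin : ∀ {k} → (Fin k → ℚ) → ℚ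
minFin {zero}  f = 1ℚ
minFin {suc k} f = f zero ⊓ minFin {k} (λ i → f (suc i))

partValue : (G : Graph) → (Fin (n G) → Bool) → ℚ
partValue G side = minFin (qv G side)

-- q(G): maximum over all partitions (seeded with 0; all values are > 0,
-- so this is the true maximum whenever G has ≥ 2 vertices)
q : Graph → ℚ
q G = foldr (λ side acc → partValue G side ⊔ acc) 0ℚ
        (filterᵇ isPartition (allMaps (n G)))

_□_ : Graph → Graph → Graph
G □ H = record
  { n = n G * n H
  ; adj = λ i j → adjP (remQuot {n G} (n H) i) (remQuot {n G} (n H) j)
  ; irrefl = irr
  ; sym = sy
  }
  where
  adjP : Fin (n G) × Fin (n H) → Fin (n G) × Fin (n H) → Bool
  adjP (g₁ , h₁) (g₂ , h₂) =
    (⌊ g₁ ≟ g₂ ⌋ ∧ adj H h₁ h₂) ∨ (⌊ h₁ ≟ h₂ ⌋ ∧ adj G g₁ g₂)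
  irrP : ∀ p → adjP p p ≡ false
  irrP (g , h) rewrite irrefl H h | irrefl G g
        | Data.Bool.Properties.∧-zeroʳ ⌊ g ≟ g ⌋
        | Data.Bool.Properties.∧-zeroʳ ⌊ h ≟ h ⌋ = refl
  irr : ∀ i → adjP (remQuot {n G} (n H) i) (remQuot {n G} (n H) i) ≡ false
  irr i = irrP (remQuot {n G} (n H) i)
  eqb : ∀ {k} (a b : Fin k) → ⌊ a ≟ b ⌋ ≡ ⌊ b ≟ a ⌋
  eqb a b with a ≟ b | b ≟ a
  ... | yes _ | yes _ = refl
  ... | no _  | no _  = refl
  ... | yes p | no ¬q = ⊥-elim (¬q (Eq.sym p))
  ... | no ¬p | yes q = ⊥-elim (¬p (Eq.sym q))
  syP : ∀ p r → adjP p r ≡ adjP r p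
  syP (g₁ , h₁) (g₂ , h₂) rewrite eqb g₁ g₂ | eqb h₁ h₂ | sym G g₁ g₂ | sym H h₁ h₂ = refl
  sy : ∀ i j → adjP (remQuot {n G} (n H) i) (remQuot {n G} (n H) j)
             ≡ adjP (remQuot {n G} (n H) j) (remQuot {n G} (n H) i)
  sy i j = syP (remQuot {n G} (n H) i) (remQuot {n G} (n H) j)

-- Lift a partition (V₁,V₂) of G to G □ H through the first coordinate. The closed neighbourhood
-- of (g,h) is {g} × N_H[h] together with N_G(g) × {h}, and the first part lies entirely on the
-- side of (g,h); so q^i((g,h)) = (a + d)/(b + d), where q^i(g) = a/b and d = d_H(h) ≥ 1. As G is
-- connected, some edge crosses the partition, so the partition value m is < 1. Each a/b ≥ m gives
-- (a + d)/(b + d) > m: the fraction grows when a < b and equals 1 when a = b. Hence every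
-- partition of G is beaten by its lift, so q(G) < q(G □ H), and symmetrically for H.
module Submission where

open import Defs hiding (sym)
open import Data.Bool using (Bool; true; false; T; not; if_then_else_; _∧_; _∨_)
import Data.Bool.Properties as Bool
open import Data.Empty using (⊥-elim)
open import Data.Fin using (Fin; zero; suc; combine; remQuot; fromℕ<; _↑ˡ_; _↑ʳ_)
open import Data.Fin.Properties
  using (_≟_; remQuot-combine; combine-remQuot; combine-injectiveˡ; combine-injectiveʳ)
open import Data.Nat.Base as ℕ using (ℕ; zero; suc; _+_; _*_; _≡ᵇ_; z≤n; s≤s)
open import Data.Nat using (_≥_)
import Data.Integer.Base as ℤ
import Data.Integer.Properties as ℤ
open import Data.Rational using (ℚ; _/_; 0ℚ; 1ℚ; _⊓_; _⊔_; _<_; _≤_; toℚᵘ)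
import Data.Rational.Properties as ℚ
open import Data.Rational.Unnormalised as ℚᵘ using (mkℚᵘ; _≃_)
import Data.Rational.Unnormalised.Properties as ℚᵘ
open import Data.Sum using (inj₁; inj₂)
open import Data.List using ([]; _∷_; foldr; filter)
open import Data.List.Relation.Unary.All as All using (All; []; _∷_)
open import Data.List.Relation.Unary.All.Properties using (all-filter)
open import Data.List.Relation.Unary.Any as Any using (Any; here; there)
import Data.List.Relation.Unary.Any.Properties as Any
import Data.Nat.Properties as ℕ
open import Data.Product using (_×_; _,_; proj₁; proj₂; ∃; ∃₂; uncurry)
open import Function using (_∘_; const; Equivalence)
open import Relation.Binary.PropositionalEquality
open import Relation.Nullary using (yes; no; does; contradiction)
open import Relation.Nullary.Decidable using (⌊_⌋; isYes≗does; T?)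
open import Algebra.Properties.Semiring.Sum ℕ.+-*-semiring
  using (sum; sum-syntax; sum-cong-≗; ∑-distrib-+; sum-replicate-zero; *-distribˡ-sum)

-- Counting over Fin k

𝟙 : Bool → ℕ
𝟙 b = if b then 1 else 0

count≡∑ : ∀ {k} (p : Fin k → Bool) → count p ≡ ∑[ i < k ] 𝟙 (p i)
count≡∑ {zero}  p = refl
count≡∑ {suc k} p = cong (𝟙 (p zero) +_) (count≡∑ (p ∘ suc))

count-cong : ∀ {k} {p p′ : Fin k → Bool} → p ≗ p′ → count p ≡ count p′
count-cong {zero}  p≗p′ = refl
count-cong {suc k} p≗p′ = cong₂ _+_ (cong 𝟙 (p≗p′ zero)) (count-cong (p≗p′ ∘ suc))

count-pos : ∀ {k} (p : Fin k → Bool) {w} → p w ≡ true → 0 ℕ.< count p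
count-pos p {zero}  pw rewrite pw = s≤s z≤n
count-pos p {suc w} pw = ℕ.<-≤-trans (count-pos (p ∘ suc) pw) (ℕ.m≤n+m _ (𝟙 (p zero)))

count-witness : ∀ {k} (p : Fin k → Bool) → T (not (count p ≡ᵇ 0)) → ∃ λ w → p w ≡ true
count-witness {suc k} p c≢0 with p zero in pw
... | true  = zero , pw
... | false = let w , pw′ = count-witness (p ∘ suc) c≢0 in suc w , pw′

𝟙-∧-≤ : ∀ b c → 𝟙 (b ∧ c) ℕ.≤ 𝟙 b
𝟙-∧-≤ true  true  = ℕ.≤-refl
𝟙-∧-≤ true  false = z≤n
𝟙-∧-≤ false c     = z≤n

count-∧-≤ : ∀ {k} (p r : Fin k → Bool) → count (λ i → p i ∧ r i) ℕ.≤ count p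
count-∧-≤ {zero}  p r = z≤n
count-∧-≤ {suc k} p r = ℕ.+-mono-≤ (𝟙-∧-≤ (p zero) (r zero)) (count-∧-≤ (p ∘ suc) (r ∘ suc))

count-∧-< : ∀ {k} (p r : Fin k → Bool) {w} → p w ≡ true → r w ≡ false →
            count (λ i → p i ∧ r i) ℕ.< count p
count-∧-< p r {zero}  pw rw rewrite pw | rw = s≤s (count-∧-≤ (p ∘ suc) (r ∘ suc))
count-∧-< p r {suc w} pw rw =
  ℕ.+-mono-≤-< (𝟙-∧-≤ (p zero) (r zero)) (count-∧-< (p ∘ suc) (r ∘ suc) pw rw)

∑-↑ : ∀ m {k} (f : Fin (m + k) → ℕ) →
      sum f ≡ ∑[ i < m ] f (i ↑ˡ k) + ∑[ j < k ] f (m ↑ʳ j)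
∑-↑ zero    f = refl
∑-↑ (suc m) f = trans (cong (f zero +_) (∑-↑ m (f ∘ suc))) (sym (ℕ.+-assoc (f zero) _ _))

∑-combine : ∀ m k (f : Fin (m * k) → ℕ) → sum f ≡ ∑[ i < m ] ∑[ j < k ] f (combine i j)
∑-combine zero    k f = refl
∑-combine (suc m) k f =
  trans (∑-↑ k f) (cong (∑[ j < k ] f (combine {suc m} zero j) +_) (∑-combine m k (f ∘ (k ↑ʳ_))))

∑-δ : ∀ {k} (x : Fin k) (f : Fin k → ℕ) → ∑[ i < k ] (𝟙 (does (i ≟ x)) * f i) ≡ f x
∑-δ {suc k} zero    f =
  trans (cong₂ _+_ (ℕ.*-identityˡ (f zero)) (sum-replicate-zero k)) (ℕ.+-identityʳ (f zero))
∑-δ {suc k} (suc x) f = ∑-δ x (f ∘ suc)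

∑∑-cross : ∀ {a b} (g : Fin a) (h : Fin b) (F : Fin b → ℕ) (K : Fin a → ℕ) →
           ∑[ g′ < a ] ∑[ h′ < b ] (𝟙 (does (g′ ≟ g)) * F h′ + 𝟙 (does (h′ ≟ h)) * K g′)
           ≡ sum F + sum K
∑∑-cross {a} {b} g h F K = begin
  ∑[ g′ < a ] ∑[ h′ < b ] (δ g′ g * F h′ + δ h′ h * K g′)
    ≡⟨ sum-cong-≗ (λ g′ → ∑-distrib-+ (λ h′ → δ g′ g * F h′) (λ h′ → δ h′ h * K g′)) ⟩
  ∑[ g′ < a ] (∑[ h′ < b ] (δ g′ g * F h′) + ∑[ h′ < b ] (δ h′ h * K g′))
    ≡⟨ sum-cong-≗ (λ g′ → cong₂ _+_ (sym (*-distribˡ-sum (δ g′ g) F)) (∑-δ h (const (K g′)))) ⟩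
  ∑[ g′ < a ] (δ g′ g * sum F + K g′)
    ≡⟨ ∑-distrib-+ (λ g′ → δ g′ g * sum F) K ⟩
  ∑[ g′ < a ] (δ g′ g * sum F) + sum K
    ≡⟨ cong (_+ sum K) (∑-δ g (const (sum F))) ⟩
  sum F + sum K ∎
  where
  open ≡-Reasoning
  δ : ∀ {k} → Fin k → Fin k → ℕ
  δ x y = 𝟙 (does (x ≟ y))

count-cross : ∀ {a b} (p : Fin (a * b) → Bool) (g : Fin a) (h : Fin b)
              (f : Fin b → Bool) (k : Fin a → Bool) →
              (∀ g′ h′ → 𝟙 (p (combine g′ h′))
                         ≡ 𝟙 (does (g′ ≟ g)) * 𝟙 (f h′) + 𝟙 (does (h′ ≟ h)) * 𝟙 (k g′)) →
              count p ≡ count f + count k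
count-cross {a} {b} p g h f k split = begin
  count p                                      ≡⟨ count≡∑ p ⟩
  ∑[ u < a * b ] 𝟙 (p u)                       ≡⟨ ∑-combine a b (𝟙 ∘ p) ⟩
  ∑[ g′ < a ] ∑[ h′ < b ] 𝟙 (p (combine g′ h′)) ≡⟨ sum-cong-≗ (sum-cong-≗ ∘ split) ⟩
  ∑[ g′ < a ] ∑[ h′ < b ] (𝟙 (does (g′ ≟ g)) * 𝟙 (f h′) + 𝟙 (does (h′ ≟ h)) * 𝟙 (k g′))
                                               ≡⟨ ∑∑-cross g h (𝟙 ∘ f) (𝟙 ∘ k) ⟩
  ∑[ h′ < b ] 𝟙 (f h′) + ∑[ g′ < a ] 𝟙 (k g′)  ≡⟨ sym (cong₂ _+_ (count≡∑ f) (count≡∑ k)) ⟩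
  count f + count k                            ∎
  where open ≡-Reasoning

-- Closed neighbourhoods and partitions

count-closedNbr-∧ : ∀ (X : Graph) x (p : Fin (n X) → Bool) →
                    count (λ u → closedNbr X x u ∧ p u) ≡ 𝟙 (p x) + count (λ u → adj X x u ∧ p u)
count-closedNbr-∧ X x p = begin
  count (λ u → closedNbr X x u ∧ p u)
    ≡⟨ count≡∑ (λ u → closedNbr X x u ∧ p u) ⟩
  ∑[ u < n X ] 𝟙 (closedNbr X x u ∧ p u)
    ≡⟨ sum-cong-≗ split ⟩
  ∑[ u < n X ] (𝟙 (does (u ≟ x)) * 𝟙 (p u) + 𝟙 (adj X x u ∧ p u))
    ≡⟨ ∑-distrib-+ (λ u → 𝟙 (does (u ≟ x)) * 𝟙 (p u)) _ ⟩
  ∑[ u < n X ] (𝟙 (does (u ≟ x)) * 𝟙 (p u)) + ∑[ u < n X ] 𝟙 (adj X x u ∧ p u)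
    ≡⟨ cong₂ _+_ (∑-δ x (𝟙 ∘ p)) (sym (count≡∑ (λ u → adj X x u ∧ p u))) ⟩
  𝟙 (p x) + count (λ u → adj X x u ∧ p u) ∎
  where
  open ≡-Reasoning
  split : ∀ u → 𝟙 (closedNbr X x u ∧ p u) ≡ 𝟙 (does (u ≟ x)) * 𝟙 (p u) + 𝟙 (adj X x u ∧ p u)
  split u with u ≟ x
  ... | no _ = refl
  ... | yes refl rewrite irrefl X u with p u
  ...   | true  = refl
  ...   | false = refl

count-closedNbr : ∀ (X : Graph) x → count (closedNbr X x) ≡ cdeg X x
count-closedNbr X x = begin
  count (closedNbr X x)                ≡⟨ count-cong (sym ∘ Bool.∧-identityʳ ∘ closedNbr X x) ⟩
  count (λ u → closedNbr X x u ∧ true) ≡⟨ count-closedNbr-∧ X x (const true) ⟩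
  suc (count (λ u → adj X x u ∧ true)) ≡⟨ cong suc (count-cong (Bool.∧-identityʳ ∘ adj X x)) ⟩
  cdeg X x                             ∎
  where open ≡-Reasoning

sameSideCount : (X : Graph) → (Fin (n X) → Bool) → Fin (n X) → ℕ
sameSideCount X side x = count (λ u → closedNbr X x u ∧ ⌊ side u Bool.≟ side x ⌋)

⌊b≟b⌋ : ∀ b → ⌊ b Bool.≟ b ⌋ ≡ true
⌊b≟b⌋ b = cong ⌊_⌋ (≡-≟-identity Bool._≟_ refl)

sameSideCount-suc : ∀ (X : Graph) side x →
                    sameSideCount X side x ≡ suc (count (λ u → adj X x u ∧ ⌊ side u Bool.≟ side x ⌋))
sameSideCount-suc X side x =
  trans (count-closedNbr-∧ X x same)
        (cong (λ b → 𝟙 b + count (λ u → adj X x u ∧ same u)) (⌊b≟b⌋ (side x)))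
  where
  same : Fin (n X) → Bool
  same u = ⌊ side u Bool.≟ side x ⌋

sameSideCount-const : ∀ (X : Graph) b x → sameSideCount X (const b) x ≡ cdeg X x
sameSideCount-const X b x = begin
  count (λ u → closedNbr X x u ∧ ⌊ b Bool.≟ b ⌋)
    ≡⟨ count-cong (λ u → cong (closedNbr X x u ∧_) (⌊b≟b⌋ b)) ⟩
  count (λ u → closedNbr X x u ∧ true)
    ≡⟨ count-cong (Bool.∧-identityʳ ∘ closedNbr X x) ⟩
  count (closedNbr X x)
    ≡⟨ count-closedNbr X x ⟩
  cdeg X x ∎
  where open ≡-Reasoning

sameSideCount≤cdeg : ∀ (X : Graph) side x → sameSideCount X side x ℕ.≤ cdeg X x
sameSideCount≤cdeg X side x =
  subst (sameSideCount X side x ℕ.≤_) (count-closedNbr X x) (count-∧-≤ (closedNbr X x) _)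

sameSideCount<cdeg : ∀ (X : Graph) side {x y} → adj X x y ≡ true → side x ≢ side y →
                     sameSideCount X side x ℕ.< cdeg X x
sameSideCount<cdeg X side {x} {y} xy sx≢sy =
  subst (sameSideCount X side x ℕ.<_) (count-closedNbr X x)
        (count-∧-< (closedNbr X x) (λ u → ⌊ side u Bool.≟ side x ⌋) y∈N[x] sy≢sx)
  where
  sy≢sx : ⌊ side y Bool.≟ side x ⌋ ≡ false
  sy≢sx = cong ⌊_⌋ (≢-≟-identity Bool._≟_ (sx≢sy ∘ sym))
  y∈N[x] : closedNbr X x y ≡ true
  y∈N[x] = trans (cong (⌊ y ≟ x ⌋ ∨_) xy) (Bool.∨-zeroʳ _)

walk-crossing : ∀ {X : Graph} (side : Fin (n X) → Bool) {u v} → Walk X u v → side u ≢ side v →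
                ∃₂ λ x y → adj X x y ≡ true × side x ≢ side y
walk-crossing side here                   su≢sv = ⊥-elim (su≢sv refl)
walk-crossing side {u} (step {v = w} uw walk) su≢sv with side u Bool.≟ side w
... | yes su≡sw = walk-crossing side walk (su≢sv ∘ trans su≡sw)
... | no  su≢sw = u , w , uw , su≢sw

isPartition-intro : ∀ {k} (side : Fin k → Bool) {u v} → side u ≡ true → side v ≡ false →
                    T (isPartition side)
isPartition-intro side {u} {v} su sv
  with count side | count-pos side su | count (not ∘ side) | count-pos (not ∘ side) (cong not sv)
... | suc _ | _ | suc _ | _ = _

isPartition-sides : ∀ {k} (side : Fin k → Bool) → T (isPartition side) →
                    ∃₂ λ u v → side u ≡ true × side v ≡ false
isPartition-sides side part with Equivalence.to Bool.T-∧ part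
... | hasTrue , hasFalse with count-witness side hasTrue | count-witness (not ∘ side) hasFalse
...   | u , su | v , sv = u , v , su , Bool.not-injective sv

isPartition-cong : ∀ {k} {side side′ : Fin k → Bool} → side ≗ side′ →
                   isPartition side ≡ isPartition side′
isPartition-cong eq =
  cong₂ (λ a b → not (a ≡ᵇ 0) ∧ not (b ≡ᵇ 0)) (count-cong eq) (count-cong (cong not ∘ eq))

partition-exists : ∀ {k} → 2 ℕ.≤ k → ∃ λ (side : Fin k → Bool) → T (isPartition side)
partition-exists (s≤s (s≤s _)) = side , isPartition-intro side {zero} {suc zero} refl refl
  where
  side : Fin _ → Bool
  side zero    = true
  side (suc _) = false

crossing-edge : ∀ (X : Graph) side → Connected X → T (isPartition side) →
                ∃₂ λ x y → adj X x y ≡ true × side x ≢ side y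
crossing-edge X side conn part with isPartition-sides side part
... | u , v , su , sv = walk-crossing side (conn u v) λ su≡sv →
  contradiction (trans (sym su) (trans su≡sv sv)) λ ()

another-element : ∀ {k} → 2 ℕ.≤ k → (x : Fin k) → ∃ λ y → x ≢ y
another-element (s≤s (s≤s _)) zero    = suc zero , λ ()
another-element (s≤s (s≤s _)) (suc _) = zero , λ ()

degree-pos : ∀ (X : Graph) → Connected X → 2 ℕ.≤ n X → ∀ x → 0 ℕ.< degree X x
degree-pos X conn 2≤n x with another-element 2≤n x
... | y , x≢y with conn x y
...   | here          = ⊥-elim (x≢y refl)
...   | step xw _ = count-pos (adj X x) xw

-- Fractions, partition values and q

toℚᵘ-/ : ∀ a b → toℚᵘ (ℤ.+ a / suc b) ≃ mkℚᵘ (ℤ.+ a) b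
toℚᵘ-/ a b = ℚ.toℚᵘ-fromℚᵘ (mkℚᵘ (ℤ.+ a) b)

fraction-< : ∀ a b c d → a * suc d ℕ.< c * suc b → ℤ.+ a / suc b < ℤ.+ c / suc d
fraction-< a b c d ad<cb = ℚ.toℚᵘ-cancel-<
  (ℚᵘ.<-respʳ-≃ (ℚᵘ.≃-sym (toℚᵘ-/ c d)) (ℚᵘ.<-respˡ-≃ (ℚᵘ.≃-sym (toℚᵘ-/ a b))
    (ℚᵘ.*<* (subst₂ ℤ._<_ (ℤ.pos-* a (suc d)) (ℤ.pos-* c (suc b)) (ℤ.+<+ ad<cb)))))

fraction-≤ : ∀ a b c d → a * suc d ℕ.≤ c * suc b → ℤ.+ a / suc b ≤ ℤ.+ c / suc d
fraction-≤ a b c d ad≤cb = ℚ.toℚᵘ-cancel-≤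
  (ℚᵘ.≤-respʳ-≃ (ℚᵘ.≃-sym (toℚᵘ-/ c d)) (ℚᵘ.≤-respˡ-≃ (ℚᵘ.≃-sym (toℚᵘ-/ a b))
    (ℚᵘ.*≤* (subst₂ ℤ._≤_ (ℤ.pos-* a (suc d)) (ℤ.pos-* c (suc b)) (ℤ.+≤+ ad≤cb)))))

fraction-nonneg : ∀ a b → 0ℚ ≤ ℤ.+ a / suc b
fraction-nonneg a b = fraction-≤ 0 0 a b z≤n

fraction<1 : ∀ a b → a ℕ.< suc b → ℤ.+ a / suc b < 1ℚ
fraction<1 a b a<b+1 =
  fraction-< a b 1 0 (subst₂ ℕ._<_ (sym (ℕ.*-identityʳ a)) (sym (ℕ.+-identityʳ (suc b))) a<b+1)

fraction-<-add : ∀ a c d → a ℕ.< suc c → 0 ℕ.< d → ℤ.+ a / suc c < ℤ.+ (a + d) / suc (c + d)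
fraction-<-add a c d@(suc _) a<c+1 _ = fraction-< a c (a + d) (c + d) (begin-strict
  a * (suc c + d)           ≡⟨ ℕ.*-distribˡ-+ a (suc c) d ⟩
  a * suc c + a * d         <⟨ ℕ.+-monoʳ-< (a * suc c) (ℕ.*-monoˡ-< d a<c+1) ⟩
  a * suc c + suc c * d     ≡⟨ cong (a * suc c +_) (ℕ.*-comm (suc c) d) ⟩
  a * suc c + d * suc c     ≡⟨ ℕ.*-distribʳ-+ (suc c) a d ⟨
  (a + d) * suc c           ∎)
  where open ℕ.≤-Reasoning

<-fraction-add : ∀ {m} a c d → m < 1ℚ → m ≤ ℤ.+ a / suc c → a ℕ.≤ suc c → 0 ℕ.< d →
                 m < ℤ.+ (a + d) / suc (c + d)
<-fraction-add a c d m<1 m≤a/c a≤c+1 0<d with ℕ.m≤n⇒m<n∨m≡n a≤c+1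
... | inj₁ a<c+1 = ℚ.≤-<-trans m≤a/c (fraction-<-add a c d a<c+1 0<d)
... | inj₂ refl  = ℚ.<-≤-trans m<1
  (fraction-≤ 1 0 (suc c + d) (c + d) (ℕ.≤-reflexive (trans (ℕ.*-identityˡ _) (sym (ℕ.*-identityʳ _)))))

<-⊓ : ∀ {m p q} → m < p → m < q → m < p ⊓ q
<-⊓ {m} {p} {q} m<p m<q with ℚ.⊓-sel p q
... | inj₁ p⊓q≡p = subst (m <_) (sym p⊓q≡p) m<p
... | inj₂ p⊓q≡q = subst (m <_) (sym p⊓q≡q) m<q

⊔-< : ∀ {p q b} → p < b → q < b → p ⊔ q < b
⊔-< {p} {q} {b} p<b q<b with ℚ.⊔-sel p q
... | inj₁ p⊔q≡p = subst (_< b) (sym p⊔q≡p) p<b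
... | inj₂ p⊔q≡q = subst (_< b) (sym p⊔q≡q) q<b

minFin-≤ : ∀ {k} (f : Fin k → ℚ) x → minFin f ≤ f x
minFin-≤ f zero    = ℚ.p⊓q≤p (f zero) _
minFin-≤ f (suc x) = ℚ.≤-trans (ℚ.p⊓q≤q (f zero) _) (minFin-≤ (f ∘ suc) x)

minFin-glb : ∀ (_R_ : ℚ → ℚ → Set) → (∀ {m p q} → m R p → m R q → m R (p ⊓ q)) →
             ∀ {k m} (f : Fin k → ℚ) → m R 1ℚ → (∀ x → m R f x) → m R minFin f
minFin-glb _R_ R-⊓ {zero}  f m≤1 m≤f = m≤1
minFin-glb _R_ R-⊓ {suc k} f m≤1 m≤f = R-⊓ (m≤f zero) (minFin-glb _R_ R-⊓ (f ∘ suc) m≤1 (m≤f ∘ suc))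

minFin-cong : ∀ {k} {f f′ : Fin k → ℚ} → f ≗ f′ → minFin f ≡ minFin f′
minFin-cong {zero}  f≗f′ = refl
minFin-cong {suc k} f≗f′ = cong₂ _⊓_ (f≗f′ zero) (minFin-cong (f≗f′ ∘ suc))

partValue-cong : ∀ (X : Graph) {side side′} → side ≗ side′ → partValue X side ≡ partValue X side′
partValue-cong X side≗side′ = minFin-cong λ v → cong (λ c → ℤ.+ c / cdeg X v)
  (count-cong λ u → cong₂ (λ a b → closedNbr X v u ∧ ⌊ a Bool.≟ b ⌋) (side≗side′ u) (side≗side′ v))

partValue-nonneg : ∀ (X : Graph) side → 0ℚ ≤ partValue X side
partValue-nonneg X side = minFin-glb _≤_ ℚ.⊓-glb (qv X side) (fraction-nonneg 1 0)
  (λ v → fraction-nonneg (sameSideCount X side v) (degree X v))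

partValue<1 : ∀ (X : Graph) side → Connected X → T (isPartition side) → partValue X side < 1ℚ
partValue<1 X side conn part with crossing-edge X side conn part
... | x , y , xy , sx≢sy = ℚ.≤-<-trans (minFin-≤ (qv X side) x)
  (fraction<1 (sameSideCount X side x) (degree X x) (sameSideCount<cdeg X side xy sx≢sy))

foldr-⊔-< : ∀ {A : Set} (F : A → ℚ) {z b} xs → z < b → All (λ x → F x < b) xs →
            foldr (λ x acc → F x ⊔ acc) z xs < b
foldr-⊔-< F []       z<b []            = z<b
foldr-⊔-< F (x ∷ xs) z<b (Fx<b ∷ Fxs<b) = ⊔-< Fx<b (foldr-⊔-< F xs z<b Fxs<b)

≤-foldr-⊔ : ∀ {A : Set} (F : A → ℚ) {z y xs} → Any (λ x → y ≤ F x) xs →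
            y ≤ foldr (λ x acc → F x ⊔ acc) z xs
≤-foldr-⊔ F {xs = x ∷ _} (here  y≤Fx)  = ℚ.≤-trans y≤Fx (ℚ.p≤p⊔q (F x) _)
≤-foldr-⊔ F {xs = x ∷ _} (there y≤Fxs) = ℚ.≤-trans (≤-foldr-⊔ F y≤Fxs) (ℚ.p≤q⊔p (F x) _)

allMaps-complete : ∀ k (f : Fin k → Bool) → Any (_≗ f) (allMaps k)
allMaps-complete zero    f = here λ ()
allMaps-complete (suc k) f with f zero in f0
... | true  = Any.++⁺ˡ (Any.map⁺ (Any.map (λ g≗f → λ { zero → sym f0 ; (suc i) → g≗f i })
                                           (allMaps-complete k (f ∘ suc))))
... | false = Any.++⁺ʳ _ (Any.map⁺ (Any.map (λ g≗f → λ { zero → sym f0 ; (suc i) → g≗f i })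
                                            (allMaps-complete k (f ∘ suc))))

q-< : ∀ (X : Graph) {b} → 0ℚ < b → (∀ side → T (isPartition side) → partValue X side < b) → q X < b
q-< X 0<b bound = foldr-⊔-< (partValue X) _ 0<b
  (All.map (λ {side} → bound side) (all-filter (T? ∘ isPartition) (allMaps (n X))))

partValue≤q : ∀ (X : Graph) side → T (isPartition side) → partValue X side ≤ q X
partValue≤q X side part = ≤-foldr-⊔ (partValue X)
  (Any.map (λ g≗side → ℚ.≤-reflexive (partValue-cong X (sym ∘ g≗side)))
           (keep (allMaps-complete (n X) side)))
  where
  keep : ∀ {sides} → Any (_≗ side) sides → Any (_≗ side) (filter (T? ∘ isPartition) sides)
  keep listed with Any.filter⁺ (T? ∘ isPartition) listed
  ... | inj₁ kept    = kept
  ... | inj₂ notPart =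
    contradiction (subst T (sym (isPartition-cong (Any.lookup-result listed))) part) notPart

-- Inflations

-- P inflates X along proj: a vertex i of P sees the closed neighbourhood of proj i plus extra i
-- further vertices, all on its own side of any partition pulled back along proj.
record Inflation (X P : Graph) : Set where
  field
    proj               : Fin (n P) → Fin (n X)
    proj-surjective    : ∀ x → ∃ λ i → proj i ≡ x
    extra              : Fin (n P) → ℕ
    extra-pos          : ∀ i → 0 ℕ.< extra i
    sameSideCount-proj : ∀ side i → sameSideCount P (side ∘ proj) i
                                    ≡ sameSideCount X side (proj i) + extra i

module _ {X P : Graph} (I : Inflation X P) where
  open Inflation I

  cdeg-proj : ∀ i → cdeg P i ≡ cdeg X (proj i) + extra i
  cdeg-proj i = begin
    cdeg P i                                        ≡⟨ sameSideCount-const P true i ⟨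
    sameSideCount P (const true) i                  ≡⟨ sameSideCount-proj (const true) i ⟩
    sameSideCount X (const true) (proj i) + extra i
      ≡⟨ cong (_+ extra i) (sameSideCount-const X true (proj i)) ⟩
    cdeg X (proj i) + extra i                       ∎
    where open ≡-Reasoning

  qv-proj : ∀ side i → qv P (side ∘ proj) i
                       ≡ ℤ.+ (sameSideCount X side (proj i) + extra i)
                         / suc (degree X (proj i) + extra i)
  qv-proj side i = ℚ./-cong (cong ℤ.+_ (sameSideCount-proj side i)) (cdeg-proj i)

  isPartition-proj : ∀ side → T (isPartition side) → T (isPartition (side ∘ proj))
  isPartition-proj side part with isPartition-sides side part
  ... | u , v , su , sv with proj-surjective u | proj-surjective v
  ...   | i , refl | j , refl = isPartition-intro (side ∘ proj) {i} {j} su sv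

  partValue-<-proj : ∀ side → Connected X → T (isPartition side) →
                     partValue X side < partValue P (side ∘ proj)
  partValue-<-proj side conn part = minFin-glb _<_ <-⊓ (qv P (side ∘ proj)) m<1 λ i →
    subst (partValue X side <_) (sym (qv-proj side i))
      (<-fraction-add (sameSideCount X side (proj i)) (degree X (proj i)) (extra i) m<1
        (minFin-≤ (qv X side) (proj i)) (sameSideCount≤cdeg X side (proj i)) (extra-pos i))
    where
    m<1 : partValue X side < 1ℚ
    m<1 = partValue<1 X side conn part

  q-<-inflation : Connected X → 2 ℕ.≤ n X → q X < q P
  q-<-inflation conn 2≤n = q-< X 0<qP below-qP
    where
    below-qP : ∀ side → T (isPartition side) → partValue X side < q P
    below-qP side part = ℚ.<-≤-trans (partValue-<-proj side conn part)
                                      (partValue≤q P (side ∘ proj) (isPartition-proj side part))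
    0<qP : 0ℚ < q P
    0<qP with partition-exists 2≤n
    ... | side , part = ℚ.≤-<-trans (partValue-nonneg X side) (below-qP side part)

-- The cartesian product

⌊≟⌋-comm : ∀ {k} (x y : Fin k) → ⌊ x ≟ y ⌋ ≡ does (y ≟ x)
⌊≟⌋-comm x y with x ≟ y | y ≟ x
... | yes _   | yes _   = refl
... | no  _   | no  _   = refl
... | yes x≡y | no  y≢x = contradiction (sym x≡y) y≢x
... | no  x≢y | yes y≡x = contradiction (sym y≡x) x≢y

coords : (G H : Graph) → Fin (n (G □ H)) → Fin (n G) × Fin (n H)
coords G H = remQuot (n H)

module _ (G H : Graph) where

  ≟-combine : ∀ g h g′ h′ → ⌊ combine {n G} {n H} g′ h′ ≟ combine g h ⌋ ≡ does (g′ ≟ g) ∧ does (h′ ≟ h)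
  ≟-combine g h g′ h′ with g′ ≟ g | h′ ≟ h
  ... | yes refl | yes refl = cong ⌊_⌋ (≡-≟-identity _≟_ refl)
  ... | yes refl | no h′≢h  = cong ⌊_⌋ (≢-≟-identity _≟_ (h′≢h ∘ combine-injectiveʳ g′ h′ g h))
  ... | no g′≢g  | _        = cong ⌊_⌋ (≢-≟-identity _≟_ (g′≢g ∘ combine-injectiveˡ g′ h′ g h))

  adj-□ : ∀ g h g′ h′ → adj (G □ H) (combine g h) (combine g′ h′)
                        ≡ (does (g′ ≟ g) ∧ adj H h h′) ∨ (does (h′ ≟ h) ∧ adj G g g′)
  adj-□ g h g′ h′ = begin
    adj (G □ H) (combine g h) (combine g′ h′)
      ≡⟨ cong₂ adjacent (remQuot-combine g h) (remQuot-combine g′ h′) ⟩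
    (⌊ g ≟ g′ ⌋ ∧ adj H h h′) ∨ (⌊ h ≟ h′ ⌋ ∧ adj G g g′)
      ≡⟨ cong₂ (λ a b → (a ∧ adj H h h′) ∨ (b ∧ adj G g g′)) (⌊≟⌋-comm g g′) (⌊≟⌋-comm h h′) ⟩
    (does (g′ ≟ g) ∧ adj H h h′) ∨ (does (h′ ≟ h) ∧ adj G g g′) ∎
    where
    open ≡-Reasoning
    adjacent : Fin (n G) × Fin (n H) → Fin (n G) × Fin (n H) → Bool
    adjacent (g₁ , h₁) (g₂ , h₂) = (⌊ g₁ ≟ g₂ ⌋ ∧ adj H h₁ h₂) ∨ (⌊ h₁ ≟ h₂ ⌋ ∧ adj G g₁ g₂)

  -- N[(g,h)] is the disjoint union of {g} × N_H[h] and N_G(g) × {h}.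
  𝟙-closedNbr-□ : ∀ (τ : Fin (n G) × Fin (n H) → Bool) g h g′ h′ →
                  𝟙 (closedNbr (G □ H) (combine g h) (combine g′ h′) ∧ τ (g′ , h′))
                  ≡ 𝟙 (does (g′ ≟ g)) * 𝟙 (closedNbr H h h′ ∧ τ (g , h′))
                    + 𝟙 (does (h′ ≟ h)) * 𝟙 (adj G g g′ ∧ τ (g′ , h))
  𝟙-closedNbr-□ τ g h g′ h′
    rewrite ≟-combine g h g′ h′ | adj-□ g h g′ h′ | isYes≗does (h′ ≟ h)
    with g′ ≟ g | h′ ≟ h
  ... | yes refl | yes refl rewrite irrefl G g with τ (g , h)
  ...   | true  = refl
  ...   | false = refl
  𝟙-closedNbr-□ τ g h g′ h′ | yes refl | no _ with adj H h h′ | τ (g , h′)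
  ...   | true  | true  = refl
  ...   | true  | false = refl
  ...   | false | _     = refl
  𝟙-closedNbr-□ τ g h g′ h′ | no _ | yes refl = sym (ℕ.+-identityʳ _)
  𝟙-closedNbr-□ τ g h g′ h′ | no _ | no _     = refl

  coords≡⇒≡combine : ∀ {i g h} → coords G H i ≡ (g , h) → i ≡ combine g h
  coords≡⇒≡combine {i} i↦gh = trans (sym (combine-remQuot {n G} (n H) i)) (cong (uncurry combine) i↦gh)

  count-closedNbr-□ : ∀ (τ : Fin (n G) × Fin (n H) → Bool) {i g h} → coords G H i ≡ (g , h) →
                      count (λ u → closedNbr (G □ H) i u ∧ τ (coords G H u))
                      ≡ count (λ h′ → closedNbr H h h′ ∧ τ (g , h′))
                        + count (λ g′ → adj G g g′ ∧ τ (g′ , h))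
  count-closedNbr-□ τ {g = g} {h} i↦gh with refl ← coords≡⇒≡combine i↦gh =
    count-cross (λ u → closedNbr (G □ H) (combine g h) u ∧ τ (coords G H u)) g h _ _ λ g′ h′ →
      trans (cong (λ c → 𝟙 (closedNbr (G □ H) (combine g h) (combine g′ h′) ∧ τ c))
                  (remQuot-combine g′ h′))
            (𝟙-closedNbr-□ τ g h g′ h′)

  sameSideCount-□ˡ : ∀ side {i g h} → coords G H i ≡ (g , h) →
                     sameSideCount (G □ H) (side ∘ proj₁ ∘ coords G H) i
                     ≡ sameSideCount G side g + degree H h
  sameSideCount-□ˡ side {i} {g} {h} i↦gh with refl ← i↦gh = begin
    sameSideCount (G □ H) (side ∘ proj₁ ∘ coords G H) i
      ≡⟨ count-closedNbr-□ (λ p → ⌊ side (proj₁ p) Bool.≟ side g ⌋) refl ⟩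
    sameSideCount H (const (side g)) h + sameSideNbrs
      ≡⟨ cong (_+ sameSideNbrs) (sameSideCount-const H (side g) h) ⟩
    suc (degree H h + sameSideNbrs)
      ≡⟨ cong suc (ℕ.+-comm (degree H h) sameSideNbrs) ⟩
    suc sameSideNbrs + degree H h
      ≡⟨ cong (_+ degree H h) (sameSideCount-suc G side g) ⟨
    sameSideCount G side g + degree H h ∎
    where
    open ≡-Reasoning
    sameSideNbrs : ℕ
    sameSideNbrs = count (λ g′ → adj G g g′ ∧ ⌊ side g′ Bool.≟ side g ⌋)

  sameSideCount-□ʳ : ∀ side {i g h} → coords G H i ≡ (g , h) →
                     sameSideCount (G □ H) (side ∘ proj₂ ∘ coords G H) i
                     ≡ sameSideCount H side h + degree G g
  sameSideCount-□ʳ side {i} {g} {h} i↦gh with refl ← i↦gh = begin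
    sameSideCount (G □ H) (side ∘ proj₂ ∘ coords G H) i
      ≡⟨ count-closedNbr-□ (λ p → ⌊ side (proj₂ p) Bool.≟ side h ⌋) refl ⟩
    sameSideCount H side h + count (λ g′ → adj G g g′ ∧ ⌊ side h Bool.≟ side h ⌋)
      ≡⟨ cong (sameSideCount H side h +_) (count-cong λ g′ →
           trans (cong (adj G g g′ ∧_) (⌊b≟b⌋ (side h))) (Bool.∧-identityʳ (adj G g g′))) ⟩
    sameSideCount H side h + degree G g ∎
    where open ≡-Reasoning

  inflation-□ˡ : Fin (n H) → (∀ h → 0 ℕ.< degree H h) → Inflation G (G □ H)
  inflation-□ˡ h₀ H-nonisolated = record
    { proj               = proj₁ ∘ coords G H
    ; proj-surjective    = λ g → combine g h₀ , cong proj₁ (remQuot-combine g h₀)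
    ; extra              = degree H ∘ proj₂ ∘ coords G H
    ; extra-pos          = H-nonisolated ∘ proj₂ ∘ coords G H
    ; sameSideCount-proj = λ side i → sameSideCount-□ˡ side refl
    }

  inflation-□ʳ : Fin (n G) → (∀ g → 0 ℕ.< degree G g) → Inflation H (G □ H)
  inflation-□ʳ g₀ G-nonisolated = record
    { proj               = proj₂ ∘ coords G H
    ; proj-surjective    = λ h → combine g₀ h , cong proj₂ (remQuot-combine g₀ h)
    ; extra              = degree G ∘ proj₁ ∘ coords G H
    ; extra-pos          = G-nonisolated ∘ proj₁ ∘ coords G H
    ; sameSideCount-proj = λ side i → sameSideCount-□ʳ side refl
    }

proposition10 : (G H : Graph) → Connected G → Connected H → n G ≥ 2 → n H ≥ 2 →
    (q G ⊔ q H) < q (G □ H)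
proposition10 G H G-connected H-connected 2≤nG 2≤nH =
  ⊔-< (q-<-inflation G⇝G□H G-connected 2≤nG) (q-<-inflation H⇝G□H H-connected 2≤nH)
  where
  vertex : ∀ {k} → 2 ℕ.≤ k → Fin k
  vertex 2≤k = fromℕ< (ℕ.<-≤-trans ℕ.z<s 2≤k)
  G⇝G□H : Inflation G (G □ H)
  G⇝G□H = inflation-□ˡ G H (vertex 2≤nH) (degree-pos H H-connected 2≤nH)
  H⇝G□H : Inflation H (G □ H)
  H⇝G□H = inflation-□ʳ G H (vertex 2≤nG) (degree-pos G G-connected 2≤nG)
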